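{- Let $0<\gamma<\tfrac12$ and $0<\lambda<h(\gamma)$, where $h(t)=t\log_2\frac1t+(1-t)\log_2\frac1{1-t}$. Let $n$ be such that $i=\gamma n$ and $\lambda n$ are integers and $i$ is even. Let $L\subseteq\{0,1\}^n$ be the set of vectors of Hamming weight $i$, let $M$ be a uniformly random binary $\lambda n\times n$ matrix, let $C=\{x\in\{0,1\}^n: Mx=0\}$ (over $\mathbb F_2$), let $X=|L\cap C|$ and $p=2^{ -\lambda n}$. Let $K_i=\sum_{x\in L} w_x$, where $w_x(y)=(-1)^{\sum_j x_jy_j}$, viewed as a function on $\{0,1\}^n$, and $\|K_i\|_k^k=\mathbb E_y|K_i(y)|^k$ with $y$ uniform on $\{0,1\}^n$. Assume $k\le \lambda n-1$. Then \[ \mathbb E_C\,(X-\mathbb E X)^k\;\ge\;\tfrac12\, p^{k-1}\,\|K_i\|_k^k . \]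
   Context: $\mathbb E_C$ denotes expectation over the random matrix $M$ (equivalently the random code $C$). $K_i$ is the $i$-th Krawchouk polynomial viewed as a function on the Boolean cube. -}

module Defs where

open import Data.Bool using (Bool; true; false; _xor_; _∧_; if_then_else_)
open import Data.Nat using (ℕ; zero; suc; _+_; _*_; _^_; _≡ᵇ_)
open import Data.Integer as ℤ using (ℤ; +_)
open import Data.List using (List; []; _∷_; map; concatMap; length; filter; foldr)
open import Data.Nat.ListAction using (sum)
open import Data.Vec using (Vec; []; _∷_; foldr′; zipWith; count)
open import Data.Rational as ℚ using (ℚ)
open import Relation.Nullary.Decidable using (does)
import Data.Nat
import Data.Bool
open import Relation.Binary.PropositionalEquality using (_≡_)

allVecsOf : {A : Set} → List A → (n : ℕ) → List (Vec A n)
allVecsOf xs zero    = [] ∷ []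
allVecsOf xs (suc n) = concatMap (λ a → map (a ∷_) (allVecsOf xs n)) xs

-- the Boolean cube {0,1}^n (true = 1)
cube : (n : ℕ) → List (Vec Bool n)
cube n = allVecsOf (false ∷ true ∷ []) n

matrices : (m n : ℕ) → List (Vec (Vec Bool n) m)
matrices m n = allVecsOf (cube n) m

weight : {n : ℕ} → Vec Bool n → ℕ
weight v = foldr′ (λ b w → if b then suc w else w) 0 v

dot : {n : ℕ} → Vec Bool n → Vec Bool n → Bool
dot x y = foldr′ _xor_ false (zipWith _∧_ x y)

inKernel : {m n : ℕ} → Vec (Vec Bool n) m → Vec Bool n → Bool
inKernel M x = foldr′ (λ r acc → if dot r x then false else acc) true M

layer : (n i : ℕ) → List (Vec Bool n)
layer n i = filter (λ x → weight x Data.Nat.≟ i) (cube n)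

X : {m n : ℕ} → (i : ℕ) → Vec (Vec Bool n) m → ℕ
X {n = n} i M = length (filter (λ x → inKernel M x Data.Bool.≟ true) (layer n i))

w : {n : ℕ} → Vec Bool n → Vec Bool n → ℤ
w x y = if dot x y then ℤ.-[1+ 0 ] else + 1

K : (n i : ℕ) → Vec Bool n → ℤ
K n i y = foldr (λ x acc → w x y ℤ.+ acc) (+ 0) (layer n i)

_^ℚ_ : ℚ → ℕ → ℚ
q ^ℚ zero  = ℚ.1ℚ
q ^ℚ suc k = q ℚ.* (q ^ℚ k)

half : ℚ
half = (+ 1) ℚ./ 2

sumℚ : {A : Set} → (A → ℚ) → List A → ℚ
sumℚ f = foldr (λ a acc → f a ℚ.+ acc) ℚ.0ℚ

EX : (m n i : ℕ) → ℚ
EX m n i = sumℚ (λ M → (+ X i M) ℚ./ 1) (matrices m n) ℚ.* (half ^ℚ (m * n))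

centralMoment : (m n i k : ℕ) → ℚ
centralMoment m n i k =
  sumℚ (λ M → (((+ X i M) ℚ./ 1) ℚ.- EX m n i) ^ℚ k) (matrices m n)
    ℚ.* (half ^ℚ (m * n))

normKpow : (n i k : ℕ) → ℚ
normKpow n i k =
  ((+ sum (map (λ y → ℤ.∣ K n i y ∣ ^ k) (cube n))) ℚ./ 1) ℚ.* (half ^ℚ n)

p : (m : ℕ) → ℚ
p m = half ^ℚ m

{-# OPTIONS --safe #-}
-- Write D(M) = 2^m X - |L| = ∑_{x ∈ L} ∑_{z ≠ 0} (-1)^{z·Mx}; since every x ∈ L is nonzero,
-- it lies in ker M with probability p, so E X = p|L| and X - E X = p D. Expanding D^k and
-- averaging over M gives ∑_{t ∈ L^k} ∑_{u ∈ (F₂^m ∖ 0)^k} c(t,u), where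
-- c(t,u) = ∑_M ∏_j (-1)^{u_j·M t_j} factors over the rows of M into the nonnegative terms
-- 2^n [∑_j u_j(ℓ) t_j = 0]. Keeping only the 2^m - 1 diagonal terms u = (z,…,z) bounds
-- E (X - E X)^k below by p^k (2^m - 1) N, where N counts the k-tuples of L with zero sum.
-- By orthogonality of characters, ‖K_i‖_k^k = E_y K_i(y)^k = N for even k, and
-- p^k (2^m - 1) = p^{k-1} (1 - p) ≥ p^{k-1}/2.

module Submission where

open import Defs
open import Function using (_∘_)
open import Data.Bool using (Bool; true; false; not; _∧_; _xor_; if_then_else_)
import Data.Bool.Properties as Boolₚ
open import Data.Nat as ℕ using (ℕ; zero; suc)
import Data.Nat.Properties as ℕₚ
open import Data.Nat.ListAction using (sum)
open import Data.List using (List; []; _∷_; _++_; map; concatMap; length; filter; drop)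
open import Data.List.Membership.Propositional using (_∈_)
open import Data.List.Membership.Propositional.Properties using (∈-filter⁻)
open import Data.List.Relation.Unary.Any using (here; there)
open import Data.Vec as Vec using (Vec; []; _∷_; replicate)
open import Data.Vec.Properties using (map-replicate)
open import Data.Product using (proj₂)
open import Relation.Nullary using (contradiction)
open import Relation.Binary.PropositionalEquality
import Data.Integer.Properties as ℤₚ
open import Data.Integer.Tactic.RingSolver using (solve-∀)
import Data.Rational.Properties as ℚₚ
import Data.Rational.Unnormalised as ℚᵘ
import Data.Rational.Unnormalised.Properties as ℚᵘₚ

module _ where
  open import Data.Integer using (ℤ; +_; -[1+_]; ∣_∣; _+_; _-_; _*_; _^_; _≤_; +≤+; nonNegative)
  open import Algebra.Properties.CommutativeSemigroup ℤₚ.+-commutativeSemigroup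
    using () renaming (interchange to +-interchange)
  open import Algebra.Properties.CommutativeSemigroup ℤₚ.*-commutativeSemigroup
    using () renaming (interchange to *-interchange)

  -- Sums over lists and over tuples

  *-nonNeg : ∀ {a b} → + 0 ≤ a → + 0 ≤ b → + 0 ≤ a * b
  *-nonNeg {a} {b} 0≤a 0≤b = ℤₚ.≤-trans (ℤₚ.≤-reflexive (sym (ℤₚ.*-zeroʳ a)))
    (ℤₚ.*-monoˡ-≤-nonNeg a {{nonNegative 0≤a}} 0≤b)

  *-mono-≤-nonNeg : ∀ {a b c d} → + 0 ≤ a → a ≤ b → + 0 ≤ c → c ≤ d → a * c ≤ b * d
  *-mono-≤-nonNeg {a} {b} {c} {d} 0≤a a≤b 0≤c c≤d = ℤₚ.≤-trans
    (ℤₚ.*-monoʳ-≤-nonNeg c {{nonNegative 0≤c}} a≤b)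
    (ℤₚ.*-monoˡ-≤-nonNeg b {{nonNegative (ℤₚ.≤-trans 0≤a a≤b)}} c≤d)

  ^-nonNeg : ∀ a k → + 0 ≤ a → + 0 ≤ a ^ k
  ^-nonNeg a zero    _   = +≤+ ℕ.z≤n
  ^-nonNeg a (suc k) 0≤a = *-nonNeg 0≤a (^-nonNeg a k 0≤a)

  -- Shaped like the folds in Defs, so that K n i y is ∑ (layer n i) (λ x → w x y) by definition.
  ∑ : {A : Set} → List A → (A → ℤ) → ℤ
  ∑ xs f = Data.List.foldr (λ a s → f a + s) (+ 0) xs

  module _ {A : Set} where

    ∑-cong-∈ : (xs : List A) {f g : A → ℤ} → (∀ {a} → a ∈ xs → f a ≡ g a) → ∑ xs f ≡ ∑ xs g
    ∑-cong-∈ []       _   = refl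
    ∑-cong-∈ (a ∷ xs) f≡g = cong₂ _+_ (f≡g (here refl)) (∑-cong-∈ xs (f≡g ∘ there))

    ∑-cong : (xs : List A) {f g : A → ℤ} → (∀ a → f a ≡ g a) → ∑ xs f ≡ ∑ xs g
    ∑-cong xs f≡g = ∑-cong-∈ xs (λ {a} _ → f≡g a)

    ∑-++ : (xs ys : List A) (f : A → ℤ) → ∑ (xs ++ ys) f ≡ ∑ xs f + ∑ ys f
    ∑-++ []       ys f = sym (ℤₚ.+-identityˡ _)
    ∑-++ (a ∷ xs) ys f = trans (cong (_+_ (f a)) (∑-++ xs ys f)) (sym (ℤₚ.+-assoc (f a) _ _))

    ∑-+ : (xs : List A) (f g : A → ℤ) → ∑ xs (λ a → f a + g a) ≡ ∑ xs f + ∑ xs g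
    ∑-+ []       f g = refl
    ∑-+ (a ∷ xs) f g = trans (cong (_+_ (f a + g a)) (∑-+ xs f g)) (+-interchange (f a) (g a) _ _)

    ∑-*ˡ : (c : ℤ) (xs : List A) (f : A → ℤ) → c * ∑ xs f ≡ ∑ xs (λ a → c * f a)
    ∑-*ˡ c []       f = ℤₚ.*-zeroʳ c
    ∑-*ˡ c (a ∷ xs) f = trans (ℤₚ.*-distribˡ-+ c (f a) _) (cong (_+_ (c * f a)) (∑-*ˡ c xs f))

    ∑-*ʳ : (c : ℤ) (xs : List A) (f : A → ℤ) → ∑ xs f * c ≡ ∑ xs (λ a → f a * c)
    ∑-*ʳ c []       f = ℤₚ.*-zeroˡ c
    ∑-*ʳ c (a ∷ xs) f = trans (ℤₚ.*-distribʳ-+ c (f a) _) (cong (_+_ (f a * c)) (∑-*ʳ c xs f))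

    ∑-1≡length : (xs : List A) → ∑ xs (λ _ → + 1) ≡ + length xs
    ∑-1≡length []       = refl
    ∑-1≡length (a ∷ xs) = cong (_+_ (+ 1)) (∑-1≡length xs)

    ∑-const : (xs : List A) (c : ℤ) → ∑ xs (λ _ → c) ≡ c * ∑ xs (λ _ → + 1)
    ∑-const xs c = trans (∑-cong xs (λ _ → sym (ℤₚ.*-identityʳ c))) (sym (∑-*ˡ c xs (λ _ → + 1)))

    ∑-nonNeg : (xs : List A) {f : A → ℤ} → (∀ a → + 0 ≤ f a) → + 0 ≤ ∑ xs f
    ∑-nonNeg []       _    = +≤+ ℕ.z≤n
    ∑-nonNeg (a ∷ xs) 0≤f = ℤₚ.+-mono-≤ (0≤f a) (∑-nonNeg xs 0≤f)

    ∑-mono-∈ : (xs : List A) {f g : A → ℤ} → (∀ {a} → a ∈ xs → f a ≤ g a) → ∑ xs f ≤ ∑ xs g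
    ∑-mono-∈ []       _   = ℤₚ.≤-refl
    ∑-mono-∈ (a ∷ xs) f≤g = ℤₚ.+-mono-≤ (f≤g (here refl)) (∑-mono-∈ xs (f≤g ∘ there))

    ∑-mono : (xs : List A) {f g : A → ℤ} → (∀ a → f a ≤ g a) → ∑ xs f ≤ ∑ xs g
    ∑-mono xs f≤g = ∑-mono-∈ xs (λ {a} _ → f≤g a)

    term≤∑ : (xs : List A) {f : A → ℤ} {a : A} → (∀ b → + 0 ≤ f b) → a ∈ xs → f a ≤ ∑ xs f
    term≤∑ (b ∷ xs) {f} 0≤f (here refl) =
      ℤₚ.i≤i+j (f b) (∑ xs f) {{nonNegative (∑-nonNeg xs 0≤f)}}
    term≤∑ (b ∷ xs) {f} 0≤f (there a∈xs) =
      ℤₚ.i≤j⇒i≤k+j (f b) {{nonNegative (0≤f b)}} (term≤∑ xs 0≤f a∈xs)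

  module _ {A B : Set} where

    ∑-map : (h : A → B) (xs : List A) (f : B → ℤ) → ∑ (map h xs) f ≡ ∑ xs (f ∘ h)
    ∑-map h []       f = refl
    ∑-map h (a ∷ xs) f = cong (_+_ (f (h a))) (∑-map h xs f)

    ∑-concatMap : (h : A → List B) (xs : List A) (f : B → ℤ) →
      ∑ (concatMap h xs) f ≡ ∑ xs (λ a → ∑ (h a) f)
    ∑-concatMap h []       f = refl
    ∑-concatMap h (a ∷ xs) f =
      trans (∑-++ (h a) (concatMap h xs) f) (cong (_+_ (∑ (h a) f)) (∑-concatMap h xs f))

    ∑-swap : (xs : List A) (ys : List B) (f : A → B → ℤ) →
      ∑ xs (λ a → ∑ ys (f a)) ≡ ∑ ys (λ b → ∑ xs (λ a → f a b))
    ∑-swap []       ys f = sym (∑-zero ys)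
      where ∑-zero : (ys : List B) → ∑ ys (λ _ → + 0) ≡ + 0
            ∑-zero []       = refl
            ∑-zero (_ ∷ ys) = trans (ℤₚ.+-identityˡ _) (∑-zero ys)
    ∑-swap (a ∷ xs) ys f =
      trans (cong (_+_ (∑ ys (f a))) (∑-swap xs ys f)) (sym (∑-+ ys (f a) _))

    ∑-product : (xs : List A) (ys : List B) (f : A → ℤ) (g : B → ℤ) →
      ∑ xs (λ a → ∑ ys (λ b → f a * g b)) ≡ ∑ xs f * ∑ ys g
    ∑-product xs ys f g =
      trans (∑-cong xs (λ a → sym (∑-*ˡ (f a) ys g))) (sym (∑-*ʳ (∑ ys g) xs f))

  ∏ : {k : ℕ} → Vec ℤ k → ℤ
  ∏ []      = + 1
  ∏ (a ∷ t) = a * ∏ t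

  module _ {A : Set} where

    ∑-allVecsOf-suc : (xs : List A) (k : ℕ) (g : Vec A (suc k) → ℤ) →
      ∑ (allVecsOf xs (suc k)) g ≡ ∑ xs (λ a → ∑ (allVecsOf xs k) (λ u → g (a ∷ u)))
    ∑-allVecsOf-suc xs k g = trans (∑-concatMap _ xs g)
      (∑-cong xs (λ a → ∑-map (a ∷_) (allVecsOf xs k) g))

    ^-∑ : (xs : List A) (f : A → ℤ) (k : ℕ) →
      ∑ xs f ^ k ≡ ∑ (allVecsOf xs k) (λ t → ∏ (Vec.map f t))
    ^-∑ xs f zero    = refl
    ^-∑ xs f (suc k) = begin
      ∑ xs f * ∑ xs f ^ k
        ≡⟨ cong (∑ xs f *_) (^-∑ xs f k) ⟩
      ∑ xs f * ∑ (allVecsOf xs k) (λ t → ∏ (Vec.map f t))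
        ≡⟨ sym (∑-product xs (allVecsOf xs k) f _) ⟩
      ∑ xs (λ a → ∑ (allVecsOf xs k) (λ t → f a * ∏ (Vec.map f t)))
        ≡⟨ sym (∑-allVecsOf-suc xs k (λ t → ∏ (Vec.map f t))) ⟩
      ∑ (allVecsOf xs (suc k)) (λ t → ∏ (Vec.map f t)) ∎
      where open ≡-Reasoning

    replicate≤∑-allVecsOf : (xs : List A) (k : ℕ) {g : Vec A k → ℤ} {a : A} →
      (∀ u → + 0 ≤ g u) → a ∈ xs → g (replicate k a) ≤ ∑ (allVecsOf xs k) g
    replicate≤∑-allVecsOf xs zero    {g} _   _    = ℤₚ.≤-reflexive (sym (ℤₚ.+-identityʳ (g [])))
    replicate≤∑-allVecsOf xs (suc k) {g} {a} 0≤g a∈xs = begin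
      g (a ∷ replicate k a)
        ≤⟨ replicate≤∑-allVecsOf xs k (λ u → 0≤g (a ∷ u)) a∈xs ⟩
      ∑ (allVecsOf xs k) (λ u → g (a ∷ u))
        ≤⟨ term≤∑ xs (λ b → ∑-nonNeg (allVecsOf xs k) (λ u → 0≤g (b ∷ u))) a∈xs ⟩
      ∑ xs (λ b → ∑ (allVecsOf xs k) (λ u → g (b ∷ u)))
        ≡⟨ sym (∑-allVecsOf-suc xs k g) ⟩
      ∑ (allVecsOf xs (suc k)) g ∎
      where open ℤₚ.≤-Reasoning

    ∑-diagonal≤∑-allVecsOf : (xs : List A) (k : ℕ) {g : Vec A (suc k) → ℤ} →
      (∀ u → + 0 ≤ g u) → ∑ xs (λ a → g (replicate (suc k) a)) ≤ ∑ (allVecsOf xs (suc k)) g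
    ∑-diagonal≤∑-allVecsOf xs k {g} 0≤g = ℤₚ.≤-trans
      (∑-mono-∈ xs (replicate≤∑-allVecsOf xs k (λ u → 0≤g (_ ∷ u))))
      (ℤₚ.≤-reflexive (sym (∑-allVecsOf-suc xs k g)))

  module _ {A B : Set} where

    ∑-∏ : (ys : List B) (φ : A → B → ℤ) {k : ℕ} (t : Vec A k) →
      ∑ (allVecsOf ys k) (λ u → ∏ (Vec.zipWith φ t u)) ≡ ∏ (Vec.map (λ x → ∑ ys (φ x)) t)
    ∑-∏ ys φ []          = refl
    ∑-∏ ys φ {suc k} (x ∷ t) = begin
      ∑ (allVecsOf ys (suc k)) (λ u → ∏ (Vec.zipWith φ (x ∷ t) u))
        ≡⟨ ∑-allVecsOf-suc ys k (λ u → ∏ (Vec.zipWith φ (x ∷ t) u)) ⟩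
      ∑ ys (λ b → ∑ (allVecsOf ys k) (λ u → φ x b * ∏ (Vec.zipWith φ t u)))
        ≡⟨ ∑-product ys (allVecsOf ys k) (φ x) _ ⟩
      ∑ ys (φ x) * ∑ (allVecsOf ys k) (λ u → ∏ (Vec.zipWith φ t u))
        ≡⟨ cong (∑ ys (φ x) *_) (∑-∏ ys φ t) ⟩
      ∑ ys (φ x) * ∏ (Vec.map (λ x → ∑ ys (φ x)) t) ∎
      where open ≡-Reasoning

  -- Characters of the Boolean cube

  2ℤ : ℤ
  2ℤ = + 2

  -- w x y from Defs unfolds to sgn (dot x y).
  sgn : Bool → ℤ
  sgn b = if b then -[1+ 0 ] else + 1

  𝟙 : Bool → ℤ
  𝟙 b = if b then + 1 else + 0

  sgn-xor : ∀ a b → sgn (a xor b) ≡ sgn a * sgn b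
  sgn-xor false b     = sym (ℤₚ.*-identityˡ (sgn b))
  sgn-xor true  false = refl
  sgn-xor true  true  = refl

  𝟙-nonNeg : ∀ b → + 0 ≤ 𝟙 b
  𝟙-nonNeg false = +≤+ ℕ.z≤n
  𝟙-nonNeg true  = +≤+ ℕ.z≤n

  𝟙≤1 : ∀ b → 𝟙 b ≤ + 1
  𝟙≤1 false = +≤+ ℕ.z≤n
  𝟙≤1 true  = ℤₚ.≤-refl

  𝟙-idem : ∀ b → 𝟙 b * 𝟙 b ≡ 𝟙 b
  𝟙-idem false = refl
  𝟙-idem true  = refl

  2*𝟙-not : ∀ b → 2ℤ * 𝟙 (not b) ≡ + 1 + sgn b
  2*𝟙-not false = refl
  2*𝟙-not true  = refl

  zeros : (n : ℕ) → Vec Bool n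
  zeros n = replicate n false

  isZero : {n : ℕ} → Vec Bool n → Bool
  isZero []      = true
  isZero (b ∷ v) = not b ∧ isZero v

  isZero-zeros : (n : ℕ) → isZero (zeros n) ≡ true
  isZero-zeros zero    = refl
  isZero-zeros (suc n) = isZero-zeros n

  infixl 6 _⊕_
  _⊕_ : {n : ℕ} → Vec Bool n → Vec Bool n → Vec Bool n
  _⊕_ = Vec.zipWith _xor_

  ⊕-identityˡ : {n : ℕ} (x : Vec Bool n) → zeros n ⊕ x ≡ x
  ⊕-identityˡ []      = refl
  ⊕-identityˡ (b ∷ x) = cong (b ∷_) (⊕-identityˡ x)

  w-∷ : {n : ℕ} (a b : Bool) (x y : Vec Bool n) → w (a ∷ x) (b ∷ y) ≡ sgn (a ∧ b) * w x y
  w-∷ a b x y = sgn-xor (a ∧ b) (dot x y)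

  w-comm : {n : ℕ} (x y : Vec Bool n) → w x y ≡ w y x
  w-comm []      []      = refl
  w-comm (a ∷ x) (b ∷ y) = begin
    w (a ∷ x) (b ∷ y)      ≡⟨ w-∷ a b x y ⟩
    sgn (a ∧ b) * w x y    ≡⟨ cong₂ _*_ (cong sgn (Boolₚ.∧-comm a b)) (w-comm x y) ⟩
    sgn (b ∧ a) * w y x    ≡⟨ sym (w-∷ b a y x) ⟩
    w (b ∷ y) (a ∷ x)      ∎
    where open ≡-Reasoning

  w-zerosˡ : {n : ℕ} (y : Vec Bool n) → w (zeros n) y ≡ + 1
  w-zerosˡ []      = refl
  w-zerosˡ (b ∷ y) = w-zerosˡ y

  w-zerosʳ : {n : ℕ} (x : Vec Bool n) → w x (zeros n) ≡ + 1
  w-zerosʳ x = trans (w-comm x _) (w-zerosˡ x)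

  w-⊕ʳ : {n : ℕ} (x y z : Vec Bool n) → w x (y ⊕ z) ≡ w x y * w x z
  w-⊕ʳ []      []      []      = refl
  w-⊕ʳ (a ∷ x) (b ∷ y) (c ∷ z) = begin
    w (a ∷ x) ((b xor c) ∷ y ⊕ z)
      ≡⟨ w-∷ a (b xor c) x (y ⊕ z) ⟩
    sgn (a ∧ (b xor c)) * w x (y ⊕ z)
      ≡⟨ cong₂ _*_ (trans (cong sgn (Boolₚ.∧-distribˡ-xor a b c)) (sgn-xor (a ∧ b) (a ∧ c)))
                   (w-⊕ʳ x y z) ⟩
    (sgn (a ∧ b) * sgn (a ∧ c)) * (w x y * w x z)
      ≡⟨ *-interchange (sgn (a ∧ b)) (sgn (a ∧ c)) (w x y) (w x z) ⟩
    (sgn (a ∧ b) * w x y) * (sgn (a ∧ c) * w x z)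
      ≡⟨ sym (cong₂ _*_ (w-∷ a b x y) (w-∷ a c x z)) ⟩
    w (a ∷ x) (b ∷ y) * w (a ∷ x) (c ∷ z) ∎
    where open ≡-Reasoning

  ∑-cube-suc : {n : ℕ} (g : Vec Bool (suc n) → ℤ) →
    ∑ (cube (suc n)) g ≡ ∑ (cube n) (g ∘ (false ∷_)) + ∑ (cube n) (g ∘ (true ∷_))
  ∑-cube-suc {n} g = trans (∑-allVecsOf-suc (false ∷ true ∷ []) n g)
    (cong (_+_ (∑ (cube n) (g ∘ (false ∷_)))) (ℤₚ.+-identityʳ (∑ (cube n) (g ∘ (true ∷_)))))

  ∑-cube-1 : (n : ℕ) → ∑ (cube n) (λ _ → + 1) ≡ 2ℤ ^ n
  ∑-cube-1 zero    = refl
  ∑-cube-1 (suc n) = begin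
    ∑ (cube (suc n)) (λ _ → + 1)                    ≡⟨ ∑-cube-suc {n} (λ _ → + 1) ⟩
    ∑ (cube n) (λ _ → + 1) + ∑ (cube n) (λ _ → + 1) ≡⟨ cong₂ _+_ (∑-cube-1 n) (∑-cube-1 n) ⟩
    2ℤ ^ n + 2ℤ ^ n                                ≡⟨ double (2ℤ ^ n) ⟩
    2ℤ ^ suc n                                      ∎
    where open ≡-Reasoning
          double : ∀ a → a + a ≡ + 2 * a
          double = solve-∀

  orthogonality : {n : ℕ} (y : Vec Bool n) → ∑ (cube n) (λ x → w x y) ≡ 2ℤ ^ n * 𝟙 (isZero y)
  orthogonality []              = refl
  orthogonality {suc n} (b ∷ y) = begin
    ∑ (cube (suc n)) (λ x → w x (b ∷ y))
      ≡⟨ ∑-cube-suc {n} (λ x → w x (b ∷ y)) ⟩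
    ∑ (cube n) (λ x → w x y) + ∑ (cube n) (λ x → w (true ∷ x) (b ∷ y))
      ≡⟨ cong (_+_ (∑ (cube n) (λ x → w x y))) (trans (∑-cong (cube n) (λ x → w-∷ true b x y))
                             (sym (∑-*ˡ (sgn b) (cube n) (λ x → w x y)))) ⟩
    ∑ (cube n) (λ x → w x y) + sgn b * ∑ (cube n) (λ x → w x y)
      ≡⟨ cong (λ s → s + sgn b * s) (orthogonality y) ⟩
    2ℤ ^ n * 𝟙 (isZero y) + sgn b * (2ℤ ^ n * 𝟙 (isZero y))
      ≡⟨ combine b ⟩
    2ℤ ^ suc n * 𝟙 (not b ∧ isZero y) ∎
    where
      open ≡-Reasoning
      combine : ∀ b → 2ℤ ^ n * 𝟙 (isZero y) + sgn b * (2ℤ ^ n * 𝟙 (isZero y))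
                      ≡ 2ℤ ^ suc n * 𝟙 (not b ∧ isZero y)
      combine false = double (2ℤ ^ n) (𝟙 (isZero y))
        where double : ∀ a e → a * e + + 1 * (a * e) ≡ + 2 * a * e
              double = solve-∀
      combine true  = trans (cancel (2ℤ ^ n) (𝟙 (isZero y))) (sym (ℤₚ.*-zeroʳ (2ℤ ^ suc n)))
        where cancel : ∀ a e → a * e + -[1+ 0 ] * (a * e) ≡ + 0
              cancel = solve-∀

  nonzero : (n : ℕ) → List (Vec Bool n)
  nonzero n = drop 1 (cube n)

  cube≡zeros∷nonzero : (n : ℕ) → cube n ≡ zeros n ∷ nonzero n
  cube≡zeros∷nonzero zero    = refl
  cube≡zeros∷nonzero (suc n) rewrite cube≡zeros∷nonzero n = refl

  ∑-cube-split : {n : ℕ} (f : Vec Bool n → ℤ) → ∑ (cube n) f ≡ f (zeros n) + ∑ (nonzero n) f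
  ∑-cube-split {n} f = cong (λ xs → ∑ xs f) (cube≡zeros∷nonzero n)

  ∑-nonzero-1 : (n : ℕ) → ∑ (nonzero n) (λ _ → + 1) ≡ 2ℤ ^ n - + 1
  ∑-nonzero-1 n = trans (sym (1+a-1 (∑ (nonzero n) (λ _ → + 1))))
    (cong (_- + 1) (trans (sym (∑-cube-split {n} (λ _ → + 1))) (∑-cube-1 n)))
    where 1+a-1 : ∀ a → + 1 + a - + 1 ≡ a
          1+a-1 = solve-∀

  -- The random matrix

  infixr 7 _·ᵥ_
  _·ᵥ_ : {m n : ℕ} → Vec (Vec Bool n) m → Vec Bool n → Vec Bool m
  M ·ᵥ x = Vec.map (λ r → dot r x) M

  inKernel≡isZero : {m n : ℕ} (M : Vec (Vec Bool n) m) (x : Vec Bool n) → inKernel M x ≡ isZero (M ·ᵥ x)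
  inKernel≡isZero []      x = refl
  inKernel≡isZero (r ∷ M) x with dot r x
  ... | true  = refl
  ... | false = inKernel≡isZero M x

  𝟙-inKernel-∷ : {m n : ℕ} (r : Vec Bool n) (M : Vec (Vec Bool n) m) (x : Vec Bool n) →
    𝟙 (inKernel (r ∷ M) x) ≡ 𝟙 (not (dot r x)) * 𝟙 (inKernel M x)
  𝟙-inKernel-∷ r M x with dot r x
  ... | true  = refl
  ... | false = sym (ℤₚ.*-identityˡ _)

  length-filter≡∑𝟙 : {A : Set} (xs : List A) (f : A → Bool) →
    + length (filter (λ x → f x Data.Bool.≟ true) xs) ≡ ∑ xs (𝟙 ∘ f)
  length-filter≡∑𝟙 []       f = refl
  length-filter≡∑𝟙 (x ∷ xs) f with f x
  ... | true  = cong (_+_ (+ 1)) (length-filter≡∑𝟙 xs f)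
  ... | false = trans (length-filter≡∑𝟙 xs f) (sym (ℤₚ.+-identityˡ _))

  X≡∑𝟙 : {m n : ℕ} (i : ℕ) (M : Vec (Vec Bool n) m) → + X i M ≡ ∑ (layer n i) (λ x → 𝟙 (inKernel M x))
  X≡∑𝟙 {n = n} i M = length-filter≡∑𝟙 (layer n i) (inKernel M)

  layer-nonzero : {n i : ℕ} → 0 ℕ.< i → {x : Vec Bool n} → x ∈ layer n i → isZero x ≡ false
  layer-nonzero {n} {i} 0<i {x} x∈L with isZero x in x≡0
  ... | false = refl
  ... | true  = contradiction (trans (sym weight≡i) (isZero⇒weight≡0 x x≡0)) (ℕₚ.>⇒≢ 0<i)
    where
      weight≡i : weight x ≡ i
      weight≡i = proj₂ (∈-filter⁻ (λ x → weight x ℕ.≟ i) {xs = cube n} x∈L)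
      isZero⇒weight≡0 : {n : ℕ} (x : Vec Bool n) → isZero x ≡ true → weight x ≡ 0
      isZero⇒weight≡0 []          _  = refl
      isZero⇒weight≡0 (false ∷ x) eq = isZero⇒weight≡0 x eq

  ∑-𝟙-inKernel : {n : ℕ} (m : ℕ) (x : Vec Bool n) → isZero x ≡ false →
    2ℤ ^ m * ∑ (matrices m n) (λ M → 𝟙 (inKernel M x)) ≡ 2ℤ ^ (m ℕ.* n)
  ∑-𝟙-inKernel zero    x x≢0 = refl
  ∑-𝟙-inKernel {n} (suc m) x x≢0 = begin
    2ℤ ^ suc m * ∑ (matrices (suc m) n) (λ M → 𝟙 (inKernel M x))
      ≡⟨ cong (2ℤ ^ suc m *_) (∑-allVecsOf-suc (cube n) m (λ M → 𝟙 (inKernel M x))) ⟩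
    2ℤ ^ suc m * ∑ (cube n) (λ r → ∑ (matrices m n) (λ M → 𝟙 (inKernel (r ∷ M) x)))
      ≡⟨ cong (2ℤ ^ suc m *_)
           (∑-cong (cube n) (λ r → ∑-cong (matrices m n) (λ M → 𝟙-inKernel-∷ r M x))) ⟩
    2ℤ ^ suc m * ∑ (cube n) (λ r → ∑ (matrices m n) (λ M → 𝟙 (not (dot r x)) * 𝟙 (inKernel M x)))
      ≡⟨ cong (2ℤ ^ suc m *_)
           (∑-product (cube n) (matrices m n) (λ r → 𝟙 (not (dot r x))) (λ M → 𝟙 (inKernel M x))) ⟩
    2ℤ ^ suc m * (orthogonalRows * kernelMatrices)
      ≡⟨ regroup 2ℤ (2ℤ ^ m) orthogonalRows kernelMatrices ⟩
    (2ℤ * orthogonalRows) * (2ℤ ^ m * kernelMatrices)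
      ≡⟨ cong₂ _*_ 2*orthogonalRows (∑-𝟙-inKernel m x x≢0) ⟩
    2ℤ ^ n * 2ℤ ^ (m ℕ.* n)
      ≡⟨ sym (ℤₚ.^-distribˡ-+-* 2ℤ n (m ℕ.* n)) ⟩
    2ℤ ^ (suc m ℕ.* n) ∎
    where
      open ≡-Reasoning
      orthogonalRows kernelMatrices : ℤ
      orthogonalRows = ∑ (cube n) (λ r → 𝟙 (not (dot r x)))
      kernelMatrices    = ∑ (matrices m n) (λ M → 𝟙 (inKernel M x))
      regroup : ∀ a b c d → a * b * (c * d) ≡ (a * c) * (b * d)
      regroup = solve-∀
      2*orthogonalRows : 2ℤ * orthogonalRows ≡ 2ℤ ^ n
      2*orthogonalRows = begin
        2ℤ * orthogonalRows
          ≡⟨ ∑-*ˡ 2ℤ (cube n) (λ r → 𝟙 (not (dot r x))) ⟩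
        ∑ (cube n) (λ r → 2ℤ * 𝟙 (not (dot r x)))
          ≡⟨ ∑-cong (cube n) (λ r → 2*𝟙-not (dot r x)) ⟩
        ∑ (cube n) (λ r → + 1 + w r x)
          ≡⟨ ∑-+ (cube n) (λ _ → + 1) (λ r → w r x) ⟩
        ∑ (cube n) (λ _ → + 1) + ∑ (cube n) (λ r → w r x)
          ≡⟨ cong₂ _+_ (∑-cube-1 n) (orthogonality x) ⟩
        2ℤ ^ n + 2ℤ ^ n * 𝟙 (isZero x)
          ≡⟨ cong (λ b → 2ℤ ^ n + 2ℤ ^ n * 𝟙 b) x≢0 ⟩
        2ℤ ^ n + 2ℤ ^ n * + 0
          ≡⟨ a+a*0 (2ℤ ^ n) ⟩
        2ℤ ^ n ∎
        where a+a*0 : ∀ a → a + a * + 0 ≡ a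
              a+a*0 = solve-∀

  ∑-X : {m n : ℕ} (i : ℕ) → 0 ℕ.< i →
    2ℤ ^ m * ∑ (matrices m n) (λ M → + X i M) ≡ 2ℤ ^ (m ℕ.* n) * + length (layer n i)
  ∑-X {m} {n} i 0<i = begin
    2ℤ ^ m * ∑ Ms (λ M → + X i M)
      ≡⟨ cong (2ℤ ^ m *_) (∑-cong Ms (X≡∑𝟙 i)) ⟩
    2ℤ ^ m * ∑ Ms (λ M → ∑ L (λ x → 𝟙 (inKernel M x)))
      ≡⟨ cong (2ℤ ^ m *_) (∑-swap Ms L (λ M x → 𝟙 (inKernel M x))) ⟩
    2ℤ ^ m * ∑ L (λ x → ∑ Ms (λ M → 𝟙 (inKernel M x)))
      ≡⟨ ∑-*ˡ (2ℤ ^ m) L (λ x → ∑ Ms (λ M → 𝟙 (inKernel M x))) ⟩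
    ∑ L (λ x → 2ℤ ^ m * ∑ Ms (λ M → 𝟙 (inKernel M x)))
      ≡⟨ ∑-cong-∈ L (λ x∈L → ∑-𝟙-inKernel m _ (layer-nonzero 0<i x∈L)) ⟩
    ∑ L (λ _ → 2ℤ ^ (m ℕ.* n))
      ≡⟨ ∑-const L (2ℤ ^ (m ℕ.* n)) ⟩
    2ℤ ^ (m ℕ.* n) * ∑ L (λ _ → + 1)
      ≡⟨ cong (2ℤ ^ (m ℕ.* n) *_) (∑-1≡length L) ⟩
    2ℤ ^ (m ℕ.* n) * + length L ∎
    where open ≡-Reasoning
          Ms = matrices m n
          L  = layer n i

  -- Moments of D

  D : {m n : ℕ} (i : ℕ) → Vec (Vec Bool n) m → ℤ
  D {m} {n} i M = ∑ (layer n i) (λ x → ∑ (nonzero m) (λ z → w z (M ·ᵥ x)))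

  2^m*X≡|L|+D : {m n : ℕ} (i : ℕ) (M : Vec (Vec Bool n) m) →
    2ℤ ^ m * + X i M ≡ + length (layer n i) + D i M
  2^m*X≡|L|+D {m} {n} i M = begin
    2ℤ ^ m * + X i M
      ≡⟨ trans (cong (2ℤ ^ m *_) (X≡∑𝟙 i M)) (∑-*ˡ (2ℤ ^ m) L (λ x → 𝟙 (inKernel M x))) ⟩
    ∑ L (λ x → 2ℤ ^ m * 𝟙 (inKernel M x))
      ≡⟨ ∑-cong L (λ x → trans (cong (λ b → 2ℤ ^ m * 𝟙 b) (inKernel≡isZero M x))
                               (sym (orthogonality (M ·ᵥ x)))) ⟩
    ∑ L (λ x → ∑ (cube m) (λ z → w z (M ·ᵥ x)))
      ≡⟨ ∑-cong L (λ x → trans (∑-cube-split (λ z → w z (M ·ᵥ x)))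
                               (cong (_+ ∑ (nonzero m) (λ z → w z (M ·ᵥ x))) (w-zerosˡ (M ·ᵥ x)))) ⟩
    ∑ L (λ x → + 1 + ∑ (nonzero m) (λ z → w z (M ·ᵥ x)))
      ≡⟨ ∑-+ L (λ _ → + 1) (λ x → ∑ (nonzero m) (λ z → w z (M ·ᵥ x))) ⟩
    ∑ L (λ _ → + 1) + D i M
      ≡⟨ cong (_+ D i M) (∑-1≡length L) ⟩
    + length L + D i M ∎
    where open ≡-Reasoning
          L = layer n i

  scale : {n : ℕ} → Bool → Vec Bool n → Vec Bool n
  scale {n} b x = if b then x else zeros n

  linComb : {n k : ℕ} → Vec (Vec Bool n) k → Vec Bool k → Vec Bool n
  linComb {n} []      []      = zeros n
  linComb     (x ∷ t) (b ∷ a) = scale b x ⊕ linComb t a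

  sumᵥ : {n k : ℕ} → Vec (Vec Bool n) k → Vec Bool n
  sumᵥ {k = k} t = linComb t (replicate k true)

  linComb-zeros : {n k : ℕ} (t : Vec (Vec Bool n) k) → linComb t (replicate k false) ≡ zeros n
  linComb-zeros []      = refl
  linComb-zeros (x ∷ t) = trans (⊕-identityˡ _) (linComb-zeros t)

  sgn-∧-dot : {n : ℕ} (b : Bool) (r x : Vec Bool n) → sgn (b ∧ dot r x) ≡ w r (scale b x)
  sgn-∧-dot true  r x = refl
  sgn-∧-dot false r x = sym (w-zerosʳ r)

  heads : {m k : ℕ} → Vec (Vec Bool (suc m)) k → Vec Bool k
  heads = Vec.map Vec.head

  tails : {m k : ℕ} → Vec (Vec Bool (suc m)) k → Vec (Vec Bool m) k
  tails = Vec.map Vec.tail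

  correlation : (m : ℕ) {n k : ℕ} → Vec (Vec Bool n) k → Vec (Vec Bool m) k → ℤ
  correlation m {n} t u = ∑ (matrices m n) (λ M → ∏ (Vec.zipWith (λ x z → w z (M ·ᵥ x)) t u))

  ∏-w-row-split : {m n k : ℕ} (r : Vec Bool n) (M : Vec (Vec Bool n) m)
    (t : Vec (Vec Bool n) k) (u : Vec (Vec Bool (suc m)) k) →
    ∏ (Vec.zipWith (λ x z → w z ((r ∷ M) ·ᵥ x)) t u)
      ≡ w r (linComb t (heads u)) * ∏ (Vec.zipWith (λ x z → w z (M ·ᵥ x)) t (tails u))
  ∏-w-row-split r M []      []            = sym (cong (_* + 1) (w-zerosʳ r))
  ∏-w-row-split r M (x ∷ t) ((a ∷ z) ∷ u) = begin
    w (a ∷ z) (dot r x ∷ M ·ᵥ x) * ∏ (Vec.zipWith (λ x z → w z ((r ∷ M) ·ᵥ x)) t u)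
      ≡⟨ cong₂ _*_ (w-∷ a (dot r x) z (M ·ᵥ x)) (∏-w-row-split r M t u) ⟩
    (sgn (a ∧ dot r x) * w z (M ·ᵥ x)) * (w r (linComb t (heads u)) * rest)
      ≡⟨ *-interchange (sgn (a ∧ dot r x)) (w z (M ·ᵥ x)) (w r (linComb t (heads u))) rest ⟩
    (sgn (a ∧ dot r x) * w r (linComb t (heads u))) * (w z (M ·ᵥ x) * rest)
      ≡⟨ cong (_* (w z (M ·ᵥ x) * rest))
           (trans (cong (_* w r (linComb t (heads u))) (sgn-∧-dot a r x))
                  (sym (w-⊕ʳ r (scale a x) (linComb t (heads u))))) ⟩
    w r (scale a x ⊕ linComb t (heads u)) * (w z (M ·ᵥ x) * rest) ∎
    where open ≡-Reasoning
          rest = ∏ (Vec.zipWith (λ x z → w z (M ·ᵥ x)) t (tails u))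

  correlation-zero : {n k : ℕ} (t : Vec (Vec Bool n) k) (u : Vec (Vec Bool 0) k) →
    correlation 0 t u ≡ + 1
  correlation-zero t u = trans (ℤₚ.+-identityʳ _) (∏-ones t u)
    where ∏-ones : {k : ℕ} (t : Vec (Vec Bool _) k) (u : Vec (Vec Bool 0) k) →
                   ∏ (Vec.zipWith (λ x z → w z ([] ·ᵥ x)) t u) ≡ + 1
          ∏-ones []      []       = refl
          ∏-ones (x ∷ t) ([] ∷ u) = trans (ℤₚ.*-identityˡ _) (∏-ones t u)

  correlation-suc : (m : ℕ) {n k : ℕ} (t : Vec (Vec Bool n) k) (u : Vec (Vec Bool (suc m)) k) →
    correlation (suc m) t u ≡ 2ℤ ^ n * 𝟙 (isZero (linComb t (heads u))) * correlation m t (tails u)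
  correlation-suc m {n} t u = begin
    correlation (suc m) t u
      ≡⟨ ∑-allVecsOf-suc (cube n) m (λ M → ∏ (Vec.zipWith (λ x z → w z (M ·ᵥ x)) t u)) ⟩
    ∑ (cube n) (λ r → ∑ (matrices m n) (λ M → ∏ (Vec.zipWith (λ x z → w z ((r ∷ M) ·ᵥ x)) t u)))
      ≡⟨ ∑-cong (cube n) (λ r → ∑-cong (matrices m n) (λ M → ∏-w-row-split r M t u)) ⟩
    ∑ (cube n) (λ r → ∑ (matrices m n) (λ M → w r (linComb t (heads u)) * rest M))
      ≡⟨ ∑-product (cube n) (matrices m n) (λ r → w r (linComb t (heads u))) rest ⟩
    ∑ (cube n) (λ r → w r (linComb t (heads u))) * correlation m t (tails u)
      ≡⟨ cong (_* correlation m t (tails u)) (orthogonality (linComb t (heads u))) ⟩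
    2ℤ ^ n * 𝟙 (isZero (linComb t (heads u))) * correlation m t (tails u) ∎
    where open ≡-Reasoning
          rest : Vec (Vec Bool n) m → ℤ
          rest M = ∏ (Vec.zipWith (λ x z → w z (M ·ᵥ x)) t (tails u))

  correlation-nonNeg : (m : ℕ) {n k : ℕ} (t : Vec (Vec Bool n) k) (u : Vec (Vec Bool m) k) →
    + 0 ≤ correlation m t u
  correlation-nonNeg zero    t u = ℤₚ.≤-trans (+≤+ ℕ.z≤n) (ℤₚ.≤-reflexive (sym (correlation-zero t u)))
  correlation-nonNeg (suc m) {n} t u = ℤₚ.≤-trans
    (*-nonNeg (*-nonNeg (^-nonNeg 2ℤ n (+≤+ ℕ.z≤n)) (𝟙-nonNeg _)) (correlation-nonNeg m t (tails u)))
    (ℤₚ.≤-reflexive (sym (correlation-suc m t u)))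

  𝟙-isZero-sumᵥ≤ : {n k : ℕ} (t : Vec (Vec Bool n) k) (a : Bool) →
    𝟙 (isZero (sumᵥ t)) ≤ 𝟙 (isZero (linComb t (replicate k a)))
  𝟙-isZero-sumᵥ≤     t true  = ℤₚ.≤-refl
  𝟙-isZero-sumᵥ≤ {n} t false rewrite linComb-zeros t | isZero-zeros n = 𝟙≤1 _

  correlation-diagonal : (m : ℕ) {n k : ℕ} (t : Vec (Vec Bool n) k) (z : Vec Bool m) →
    2ℤ ^ (m ℕ.* n) * 𝟙 (isZero (sumᵥ t)) ≤ correlation m t (replicate k z)
  correlation-diagonal zero t [] = begin
    + 1 * 𝟙 (isZero (sumᵥ t))  ≡⟨ ℤₚ.*-identityˡ _ ⟩
    𝟙 (isZero (sumᵥ t))        ≤⟨ 𝟙≤1 _ ⟩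
    + 1                        ≡⟨ sym (correlation-zero t _) ⟩
    correlation 0 t (replicate _ []) ∎
    where open ℤₚ.≤-Reasoning
  correlation-diagonal (suc m) {n} {k} t (a ∷ z) = begin
    2ℤ ^ (n ℕ.+ m ℕ.* n) * s
      ≡⟨ split (2ℤ ^ n) (2ℤ ^ (m ℕ.* n)) s (ℤₚ.^-distribˡ-+-* 2ℤ n (m ℕ.* n)) (𝟙-idem _) ⟩
    (2ℤ ^ n * s) * (2ℤ ^ (m ℕ.* n) * s)
      ≤⟨ *-mono-≤-nonNeg (*-nonNeg 0≤2^n (𝟙-nonNeg _))
           (ℤₚ.*-monoˡ-≤-nonNeg (2ℤ ^ n) {{nonNegative 0≤2^n}} (𝟙-isZero-sumᵥ≤ t a))
           (*-nonNeg (^-nonNeg 2ℤ (m ℕ.* n) (+≤+ ℕ.z≤n)) (𝟙-nonNeg _))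
           (correlation-diagonal m t z) ⟩
    2ℤ ^ n * 𝟙 (isZero (linComb t (replicate k a))) * correlation m t (replicate k z)
      ≡⟨ sym (cong₂ (λ h v → 2ℤ ^ n * 𝟙 (isZero (linComb t h)) * correlation m t v)
                    (map-replicate Vec.head (a ∷ z) k) (map-replicate Vec.tail (a ∷ z) k)) ⟩
    2ℤ ^ n * 𝟙 (isZero (linComb t (heads (replicate k (a ∷ z))))) * correlation m t (tails (replicate k (a ∷ z)))
      ≡⟨ sym (correlation-suc m t (replicate k (a ∷ z))) ⟩
    correlation (suc m) t (replicate k (a ∷ z)) ∎
    where
      open ℤₚ.≤-Reasoning
      s = 𝟙 (isZero (sumᵥ t))
      0≤2^n : + 0 ≤ 2ℤ ^ n
      0≤2^n = ^-nonNeg 2ℤ n (+≤+ ℕ.z≤n)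
      split : ∀ a b s {ab} → ab ≡ a * b → s * s ≡ s → ab * s ≡ (a * s) * (b * s)
      split a b s refl ss≡s = trans (cong (a * b *_) (sym ss≡s)) (*-interchange a b s s)

  zeroSumTuples : (n i k : ℕ) → ℤ
  zeroSumTuples n i k = ∑ (allVecsOf (layer n i) k) (λ t → 𝟙 (isZero (sumᵥ t)))

  zeroSumTuples-nonNeg : (n i k : ℕ) → + 0 ≤ zeroSumTuples n i k
  zeroSumTuples-nonNeg n i k = ∑-nonNeg (allVecsOf (layer n i) k) (λ t → 𝟙-nonNeg (isZero (sumᵥ t)))

  ∑-D^k : {m n : ℕ} (i k : ℕ) →
    ∑ (matrices m n) (λ M → D i M ^ k)
      ≡ ∑ (allVecsOf (layer n i) k) (λ t → ∑ (allVecsOf (nonzero m) k) (correlation m t))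
  ∑-D^k {m} {n} i k = begin
    ∑ Ms (λ M → D i M ^ k)
      ≡⟨ ∑-cong Ms (λ M → ^-∑ L (h M) k) ⟩
    ∑ Ms (λ M → ∑ Lᵏ (λ t → ∏ (Vec.map (h M) t)))
      ≡⟨ ∑-cong Ms (λ M → ∑-cong Lᵏ (λ t → sym (∑-∏ (nonzero m) (λ x z → w z (M ·ᵥ x)) t))) ⟩
    ∑ Ms (λ M → ∑ Lᵏ (λ t → ∑ Zᵏ (λ u → ∏ (Vec.zipWith (λ x z → w z (M ·ᵥ x)) t u))))
      ≡⟨ ∑-swap Ms Lᵏ (λ M t → ∑ Zᵏ (λ u → ∏ (Vec.zipWith (λ x z → w z (M ·ᵥ x)) t u))) ⟩
    ∑ Lᵏ (λ t → ∑ Ms (λ M → ∑ Zᵏ (λ u → ∏ (Vec.zipWith (λ x z → w z (M ·ᵥ x)) t u))))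
      ≡⟨ ∑-cong Lᵏ (λ t → ∑-swap Ms Zᵏ (λ M u → ∏ (Vec.zipWith (λ x z → w z (M ·ᵥ x)) t u))) ⟩
    ∑ Lᵏ (λ t → ∑ Zᵏ (correlation m t)) ∎
    where open ≡-Reasoning
          Ms = matrices m n
          L  = layer n i
          Lᵏ = allVecsOf L k
          Zᵏ = allVecsOf (nonzero m) k
          h : Vec (Vec Bool n) m → Vec Bool n → ℤ
          h M x = ∑ (nonzero m) (λ z → w z (M ·ᵥ x))

  ∑-D^k-≥ : {m n : ℕ} (i k : ℕ) →
    (2ℤ ^ m - + 1) * (2ℤ ^ (m ℕ.* n) * zeroSumTuples n i (suc k)) ≤ ∑ (matrices m n) (λ M → D i M ^ suc k)
  ∑-D^k-≥ {m} {n} i k = begin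
    (2ℤ ^ m - + 1) * (T * zeroSumTuples n i (suc k))
      ≡⟨ cong₂ _*_ (sym (∑-nonzero-1 m)) (∑-*ˡ T Lᵏ s) ⟩
    ∑ Z (λ _ → + 1) * ∑ Lᵏ (λ t → T * s t)
      ≡⟨ ∑-*ˡ (∑ Z (λ _ → + 1)) Lᵏ (λ t → T * s t) ⟩
    ∑ Lᵏ (λ t → ∑ Z (λ _ → + 1) * (T * s t))
      ≡⟨ ∑-cong Lᵏ (λ t → trans (ℤₚ.*-comm (∑ Z (λ _ → + 1)) (T * s t)) (sym (∑-const Z (T * s t)))) ⟩
    ∑ Lᵏ (λ t → ∑ Z (λ _ → T * s t))
      ≤⟨ ∑-mono Lᵏ (λ t → ∑-mono Z (correlation-diagonal m t)) ⟩
    ∑ Lᵏ (λ t → ∑ Z (λ z → correlation m t (replicate (suc k) z)))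
      ≤⟨ ∑-mono Lᵏ (λ t → ∑-diagonal≤∑-allVecsOf Z k (correlation-nonNeg m t)) ⟩
    ∑ Lᵏ (λ t → ∑ (allVecsOf Z (suc k)) (correlation m t))
      ≡⟨ sym (∑-D^k {m} {n} i (suc k)) ⟩
    ∑ (matrices m n) (λ M → D i M ^ suc k) ∎
    where open ℤₚ.≤-Reasoning
          T  = 2ℤ ^ (m ℕ.* n)
          Z  = nonzero m
          Lᵏ = allVecsOf (layer n i) (suc k)
          s : Vec (Vec Bool n) (suc k) → ℤ
          s t = 𝟙 (isZero (sumᵥ t))

  ∏-w-sumᵥ : {n k : ℕ} (y : Vec Bool n) (t : Vec (Vec Bool n) k) →
    ∏ (Vec.map (λ x → w x y) t) ≡ w y (sumᵥ t)
  ∏-w-sumᵥ y []      = sym (w-zerosʳ y)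
  ∏-w-sumᵥ y (x ∷ t) =
    trans (cong₂ _*_ (w-comm x y) (∏-w-sumᵥ y t)) (sym (w-⊕ʳ y x (sumᵥ t)))

  ∑-K^k : (n i k : ℕ) → ∑ (cube n) (λ y → K n i y ^ k) ≡ 2ℤ ^ n * zeroSumTuples n i k
  ∑-K^k n i k = begin
    ∑ (cube n) (λ y → K n i y ^ k)
      ≡⟨ ∑-cong (cube n) (λ y → trans (^-∑ (layer n i) (λ x → w x y) k)
                                      (∑-cong Lᵏ (∏-w-sumᵥ y))) ⟩
    ∑ (cube n) (λ y → ∑ Lᵏ (λ t → w y (sumᵥ t)))
      ≡⟨ ∑-swap (cube n) Lᵏ (λ y t → w y (sumᵥ t)) ⟩
    ∑ Lᵏ (λ t → ∑ (cube n) (λ y → w y (sumᵥ t)))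
      ≡⟨ ∑-cong Lᵏ (λ t → orthogonality (sumᵥ t)) ⟩
    ∑ Lᵏ (λ t → 2ℤ ^ n * 𝟙 (isZero (sumᵥ t)))
      ≡⟨ sym (∑-*ˡ (2ℤ ^ n) Lᵏ (λ t → 𝟙 (isZero (sumᵥ t)))) ⟩
    2ℤ ^ n * zeroSumTuples n i k ∎
    where open ≡-Reasoning
          Lᵏ = allVecsOf (layer n i) k

  +sum≡∑ : {A : Set} (ys : List A) (g : A → ℕ) → + sum (map g ys) ≡ ∑ ys (λ y → + g y)
  +sum≡∑ []       g = refl
  +sum≡∑ (y ∷ ys) g = trans (ℤₚ.pos-+ (g y) _) (cong (_+_ (+ g y)) (+sum≡∑ ys g))

  +∣a∣^even : ∀ a q → + (∣ a ∣ ℕ.^ (q ℕ.* 2)) ≡ a ^ (q ℕ.* 2)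
  +∣a∣^even a zero    = refl
  +∣a∣^even a (suc q) = begin
    + (∣ a ∣ ℕ.* (∣ a ∣ ℕ.* ∣ a ∣ ℕ.^ (q ℕ.* 2)))
      ≡⟨ trans (ℤₚ.pos-* ∣ a ∣ _) (cong (_*_ (+ ∣ a ∣)) (ℤₚ.pos-* ∣ a ∣ _)) ⟩
    + ∣ a ∣ * (+ ∣ a ∣ * + (∣ a ∣ ℕ.^ (q ℕ.* 2)))
      ≡⟨ sym (ℤₚ.*-assoc (+ ∣ a ∣) (+ ∣ a ∣) _) ⟩
    + ∣ a ∣ * + ∣ a ∣ * + (∣ a ∣ ℕ.^ (q ℕ.* 2))
      ≡⟨ cong₂ _*_ (+∣a∣*+∣a∣ a) (+∣a∣^even a q) ⟩
    a * a * a ^ (q ℕ.* 2)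
      ≡⟨ ℤₚ.*-assoc a a _ ⟩
    a * (a * a ^ (q ℕ.* 2)) ∎
    where open ≡-Reasoning
          +∣a∣*+∣a∣ : ∀ a → + ∣ a ∣ * + ∣ a ∣ ≡ a * a
          +∣a∣*+∣a∣ (+ n)     = refl
          +∣a∣*+∣a∣ -[1+ n ]  = refl

-- Passing to ℚ

module _ where
  open import Data.Integer as ℤ using (ℤ; +_; -[1+_]; ∣_∣)
  open import Data.Nat.Divisibility using (_∣_; divides)
  open import Data.Rational using (ℚ; 1ℚ; _+_; _-_; _*_; -_; _≤_; *≤*; _/_; NonNegative; toℚᵘ)
  open import Algebra.Bundles using (CommutativeRing)
  open import Algebra.Properties.CommutativeSemigroup
    (CommutativeRing.*-commutativeSemigroup ℚₚ.+-*-commutativeRing)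
    using (interchange; xy∙z≈xz∙y)
  open import Algebra.Properties.AbelianGroup ℚₚ.+-0-abelianGroup using (xyx⁻¹≈y)
  open import Algebra.Properties.Ring ℚₚ.+-*-ring using (-1*x≈-x)

  ι : ℤ → ℚ
  ι z = z / 1

  -- ι z is the normal form of the unnormalised z/1, so ι inherits the algebra of ℚᵘ.
  private
    ιᵘ : ℤ → ℚᵘ.ℚᵘ
    ιᵘ z = ℚᵘ.mkℚᵘ z 0

    toℚᵘ-ι : ∀ z → toℚᵘ (ι z) ℚᵘ.≃ ιᵘ z
    toℚᵘ-ι z = ℚₚ.toℚᵘ-fromℚᵘ (ιᵘ z)

  ι-+ : ∀ a b → ι (a ℤ.+ b) ≡ ι a + ι b
  ι-+ a b = trans (ℚₚ.fromℚᵘ-cong ιᵘ[a+b]≃) (ℚₚ.fromℚᵘ-toℚᵘ (ι a + ι b))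
    where
      *1-distrib : ∀ a b → (a ℤ.+ b) ℤ.* + 1 ≡ (a ℤ.* + 1 ℤ.+ b ℤ.* + 1) ℤ.* + 1
      *1-distrib = solve-∀
      ιᵘ[a+b]≃ : ιᵘ (a ℤ.+ b) ℚᵘ.≃ toℚᵘ (ι a + ι b)
      ιᵘ[a+b]≃ = ℚᵘₚ.≃-sym (ℚᵘₚ.≃-trans (ℚₚ.toℚᵘ-homo-+ (ι a) (ι b))
        (ℚᵘₚ.≃-trans (ℚᵘₚ.+-cong (toℚᵘ-ι a) (toℚᵘ-ι b)) (ℚᵘ.*≡* (sym (*1-distrib a b)))))

  ι-* : ∀ a b → ι (a ℤ.* b) ≡ ι a * ι b
  ι-* a b = trans (ℚₚ.fromℚᵘ-cong ιᵘ[ab]≃) (ℚₚ.fromℚᵘ-toℚᵘ (ι a * ι b))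
    where
      ιᵘ[ab]≃ : ιᵘ (a ℤ.* b) ℚᵘ.≃ toℚᵘ (ι a * ι b)
      ιᵘ[ab]≃ = ℚᵘₚ.≃-sym (ℚᵘₚ.≃-trans (ℚₚ.toℚᵘ-homo-* (ι a) (ι b))
        (ℚᵘₚ.≃-trans (ℚᵘₚ.*-cong (toℚᵘ-ι a) (toℚᵘ-ι b)) (ℚᵘ.*≡* refl)))

  ι-mono : ∀ {a b} → a ℤ.≤ b → ι a ≤ ι b
  ι-mono {a} {b} a≤b = ℚₚ.toℚᵘ-cancel-≤ (ℚᵘₚ.≤-respˡ-≃ (ℚᵘₚ.≃-sym (toℚᵘ-ι a))
    (ℚᵘₚ.≤-respʳ-≃ (ℚᵘₚ.≃-sym (toℚᵘ-ι b)) (ℚᵘ.*≤* (ℤₚ.*-monoʳ-≤-nonNeg (+ 1) a≤b))))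

  ι-^ : ∀ a k → ι a ^ℚ k ≡ ι (a ℤ.^ k)
  ι-^ a zero    = refl
  ι-^ a (suc k) = trans (cong (ι a *_) (ι-^ a k)) (sym (ι-* a (a ℤ.^ k)))

  ^ℚ-distrib-* : ∀ a b k → (a * b) ^ℚ k ≡ a ^ℚ k * b ^ℚ k
  ^ℚ-distrib-* a b zero    = refl
  ^ℚ-distrib-* a b (suc k) =
    trans (cong ((a * b) *_) (^ℚ-distrib-* a b k)) (interchange a b (a ^ℚ k) (b ^ℚ k))

  1^ℚ : ∀ k → 1ℚ ^ℚ k ≡ 1ℚ
  1^ℚ zero    = refl
  1^ℚ (suc k) = trans (ℚₚ.*-identityˡ _) (1^ℚ k)

  ^ℚ-nonNeg : ∀ q .{{_ : NonNegative q}} k → NonNegative (q ^ℚ k)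
  ^ℚ-nonNeg q zero    = _
  ^ℚ-nonNeg q (suc k) = ℚₚ.nonNeg*nonNeg⇒nonNeg q (q ^ℚ k) {{^ℚ-nonNeg q k}}

  half≤1 : half ≤ 1ℚ
  half≤1 = *≤* (ℤ.+≤+ (ℕ.s≤s ℕ.z≤n))

  half^suc≤half : ∀ j → half ^ℚ suc j ≤ half
  half^suc≤half zero    = ℚₚ.≤-refl
  half^suc≤half (suc j) = ℚₚ.≤-trans (ℚₚ.*-monoˡ-≤-nonNeg half (ℚₚ.≤-trans (half^suc≤half j) half≤1))
                                     (ℚₚ.≤-reflexive (ℚₚ.*-identityʳ half))

  p^-nonNeg : ∀ m k → NonNegative (p m ^ℚ k)
  p^-nonNeg m k = ^ℚ-nonNeg (p m) {{^ℚ-nonNeg half m}} k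

  -- 1 - ½ computes to ½.
  half≤1-p : ∀ m → half ≤ 1ℚ - p (suc m)
  half≤1-p m = ℚₚ.+-monoʳ-≤ 1ℚ (ℚₚ.neg-antimono-≤ (half^suc≤half m))

  ι[2^j*z]*half^j : ∀ j z → ι (2ℤ ℤ.^ j ℤ.* z) * half ^ℚ j ≡ ι z
  ι[2^j*z]*half^j j z = begin
    ι (2ℤ ℤ.^ j ℤ.* z) * half ^ℚ j       ≡⟨ cong (_* half ^ℚ j) (trans (ι-* (2ℤ ℤ.^ j) z) (cong (_* ι z) (sym (ι-^ 2ℤ j)))) ⟩
    ι 2ℤ ^ℚ j * ι z * half ^ℚ j          ≡⟨ xy∙z≈xz∙y (ι 2ℤ ^ℚ j) (ι z) (half ^ℚ j) ⟩
    ι 2ℤ ^ℚ j * half ^ℚ j * ι z          ≡⟨ cong (_* ι z) (trans (sym (^ℚ-distrib-* (ι 2ℤ) half j)) (1^ℚ j)) ⟩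
    1ℚ * ι z                             ≡⟨ ℚₚ.*-identityˡ (ι z) ⟩
    ι z                                  ∎
    where open ≡-Reasoning

  sumℚ-ι : {A : Set} (xs : List A) (g : A → ℤ) → sumℚ (ι ∘ g) xs ≡ ι (∑ xs g)
  sumℚ-ι []       g = refl
  sumℚ-ι (a ∷ xs) g = trans (cong (_+_ (ι (g a))) (sumℚ-ι xs g)) (sym (ι-+ (g a) (∑ xs g)))

  sumℚ-*ˡ : {A : Set} (q : ℚ) (xs : List A) (f : A → ℚ) → sumℚ (λ a → q * f a) xs ≡ q * sumℚ f xs
  sumℚ-*ˡ q []       f = sym (ℚₚ.*-zeroʳ q)
  sumℚ-*ˡ q (a ∷ xs) f = trans (cong (_+_ (q * f a)) (sumℚ-*ˡ q xs f)) (sym (ℚₚ.*-distribˡ-+ q (f a) _))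

  sumℚ-cong : {A : Set} (xs : List A) {f g : A → ℚ} → (∀ a → f a ≡ g a) → sumℚ f xs ≡ sumℚ g xs
  sumℚ-cong []       _   = refl
  sumℚ-cong (a ∷ xs) f≡g = cong₂ _+_ (f≡g a) (sumℚ-cong xs f≡g)

  EX≡ : (m n i : ℕ) → 0 ℕ.< i → EX m n i ≡ ι (+ length (layer n i)) * p m
  EX≡ m n i 0<i = begin
    sumℚ (λ M → ι (+ X i M)) (matrices m n) * half ^ℚ (m ℕ.* n)
      ≡⟨ cong (_* half ^ℚ (m ℕ.* n)) (sumℚ-ι (matrices m n) (λ M → + X i M)) ⟩
    ι ∑X * half ^ℚ (m ℕ.* n)
      ≡⟨ cong (_* half ^ℚ (m ℕ.* n)) (sym (ι[2^j*z]*half^j m ∑X)) ⟩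
    ι (2ℤ ℤ.^ m ℤ.* ∑X) * p m * half ^ℚ (m ℕ.* n)
      ≡⟨ cong (λ z → ι z * p m * half ^ℚ (m ℕ.* n)) (∑-X {m} {n} i 0<i) ⟩
    ι (2ℤ ℤ.^ (m ℕ.* n) ℤ.* |L|) * p m * half ^ℚ (m ℕ.* n)
      ≡⟨ xy∙z≈xz∙y (ι (2ℤ ℤ.^ (m ℕ.* n) ℤ.* |L|)) (p m) (half ^ℚ (m ℕ.* n)) ⟩
    ι (2ℤ ℤ.^ (m ℕ.* n) ℤ.* |L|) * half ^ℚ (m ℕ.* n) * p m
      ≡⟨ cong (_* p m) (ι[2^j*z]*half^j (m ℕ.* n) |L|) ⟩
    ι |L| * p m ∎
    where open ≡-Reasoning
          ∑X  = ∑ (matrices m n) (λ M → + X i M)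
          |L| = + length (layer n i)

  X-EX≡ : {m n : ℕ} (i : ℕ) → 0 ℕ.< i → (M : Vec (Vec Bool n) m) →
    ι (+ X i M) - EX m n i ≡ ι (D i M) * p m
  X-EX≡ {m} {n} i 0<i M = begin
    ι (+ X i M) - EX m n i
      ≡⟨ cong₂ _-_ (sym (ι[2^j*z]*half^j m (+ X i M))) (EX≡ m n i 0<i) ⟩
    ι (2ℤ ℤ.^ m ℤ.* + X i M) * p m - ι |L| * p m
      ≡⟨ cong (λ z → ι z * p m - ι |L| * p m) (2^m*X≡|L|+D i M) ⟩
    ι (|L| ℤ.+ D i M) * p m - ι |L| * p m
      ≡⟨ cong (λ q → q * p m - ι |L| * p m) (ι-+ |L| (D i M)) ⟩
    (ι |L| + ι (D i M)) * p m - ι |L| * p m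
      ≡⟨ cong (_- ι |L| * p m) (ℚₚ.*-distribʳ-+ (p m) (ι |L|) (ι (D i M))) ⟩
    ι |L| * p m + ι (D i M) * p m - ι |L| * p m
      ≡⟨ xyx⁻¹≈y (ι |L| * p m) (ι (D i M) * p m) ⟩
    ι (D i M) * p m ∎
    where open ≡-Reasoning
          |L| = + length (layer n i)

  centralMoment≡ : (m n i k : ℕ) → 0 ℕ.< i →
    centralMoment m n i k ≡ p m ^ℚ k * (ι (∑ (matrices m n) (λ M → D i M ℤ.^ k)) * half ^ℚ (m ℕ.* n))
  centralMoment≡ m n i k 0<i = begin
    sumℚ (λ M → (ι (+ X i M) - EX m n i) ^ℚ k) Ms * e
      ≡⟨ cong (_* e) (sumℚ-cong Ms (λ M → cong (_^ℚ k) (X-EX≡ i 0<i M))) ⟩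
    sumℚ (λ M → (ι (D i M) * p m) ^ℚ k) Ms * e
      ≡⟨ cong (_* e) (sumℚ-cong Ms (λ M → trans (^ℚ-distrib-* (ι (D i M)) (p m) k)
           (trans (ℚₚ.*-comm (ι (D i M) ^ℚ k) (p m ^ℚ k)) (cong (p m ^ℚ k *_) (ι-^ (D i M) k))))) ⟩
    sumℚ (λ M → p m ^ℚ k * ι (D i M ℤ.^ k)) Ms * e
      ≡⟨ cong (_* e) (trans (sumℚ-*ˡ (p m ^ℚ k) Ms (λ M → ι (D i M ℤ.^ k)))
                            (cong (p m ^ℚ k *_) (sumℚ-ι Ms (λ M → D i M ℤ.^ k)))) ⟩
    p m ^ℚ k * ι (∑ Ms (λ M → D i M ℤ.^ k)) * e
      ≡⟨ ℚₚ.*-assoc (p m ^ℚ k) _ e ⟩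
    p m ^ℚ k * (ι (∑ Ms (λ M → D i M ℤ.^ k)) * e) ∎
    where open ≡-Reasoning
          Ms = matrices m n
          e  = half ^ℚ (m ℕ.* n)

  ι[2^m-1]*p≡1-p : ∀ m → ι (2ℤ ℤ.^ m ℤ.- + 1) * p m ≡ 1ℚ - p m
  ι[2^m-1]*p≡1-p m = begin
    ι (2ℤ ℤ.^ m ℤ.- + 1) * p m           ≡⟨ cong (_* p m) (ι-+ (2ℤ ℤ.^ m) -[1+ 0 ]) ⟩
    (ι (2ℤ ℤ.^ m) + - 1ℚ) * p m           ≡⟨ ℚₚ.*-distribʳ-+ (p m) (ι (2ℤ ℤ.^ m)) (- 1ℚ) ⟩
    ι (2ℤ ℤ.^ m) * p m + - 1ℚ * p m        ≡⟨ cong₂ _+_ ι[2^m]*p≡1 (-1*x≈-x (p m)) ⟩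
    1ℚ - p m                              ∎
    where open ≡-Reasoning
          ι[2^m]*p≡1 : ι (2ℤ ℤ.^ m) * p m ≡ 1ℚ
          ι[2^m]*p≡1 = trans (cong (λ z → ι z * p m) (sym (ℤₚ.*-identityʳ (2ℤ ℤ.^ m))))
                             (ι[2^j*z]*half^j m (+ 1))

  centralMoment-≥ : (m n i k : ℕ) → 0 ℕ.< i →
    (1ℚ - p m) * p m ^ℚ k * ι (zeroSumTuples n i (suc k)) ≤ centralMoment m n i (suc k)
  centralMoment-≥ m n i k 0<i = begin
    (1ℚ - p m) * p m ^ℚ k * ι N
      ≡⟨ cong (λ q → q * p m ^ℚ k * ι N) (sym (ι[2^m-1]*p≡1-p m)) ⟩
    ι c * p m * p m ^ℚ k * ι N
      ≡⟨ regroup (ι c) (p m) (p m ^ℚ k) (ι N) ⟩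
    p m ^ℚ suc k * (ι c * ι N)
      ≡⟨ cong (p m ^ℚ suc k *_) (trans (sym (ι-* c N)) (sym (ι[2^j*z]*half^j (m ℕ.* n) (c ℤ.* N)))) ⟩
    p m ^ℚ suc k * (ι (2ℤ ℤ.^ (m ℕ.* n) ℤ.* (c ℤ.* N)) * e)
      ≡⟨ cong (λ z → p m ^ℚ suc k * (ι z * e)) (reorder c (2ℤ ℤ.^ (m ℕ.* n)) N) ⟩
    p m ^ℚ suc k * (ι (c ℤ.* (2ℤ ℤ.^ (m ℕ.* n) ℤ.* N)) * e)
      ≤⟨ ℚₚ.*-monoˡ-≤-nonNeg (p m ^ℚ suc k) {{p^-nonNeg m (suc k)}}
           (ℚₚ.*-monoʳ-≤-nonNeg e {{^ℚ-nonNeg half (m ℕ.* n)}} (ι-mono (∑-D^k-≥ {m} {n} i k))) ⟩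
    p m ^ℚ suc k * (ι (∑ (matrices m n) (λ M → D i M ℤ.^ suc k)) * e)
      ≡⟨ sym (centralMoment≡ m n i (suc k) 0<i) ⟩
    centralMoment m n i (suc k) ∎
    where
      open ℚₚ.≤-Reasoning
      N = zeroSumTuples n i (suc k)
      c = 2ℤ ℤ.^ m ℤ.- + 1
      e = half ^ℚ (m ℕ.* n)
      reorder : ∀ a b c → b ℤ.* (a ℤ.* c) ≡ a ℤ.* (b ℤ.* c)
      reorder = solve-∀
      regroup : ∀ a q r b → a * q * r * b ≡ q * r * (a * b)
      regroup a q r b = begin-equality
        a * q * r * b     ≡⟨ cong (_* b) (ℚₚ.*-assoc a q r) ⟩
        a * (q * r) * b   ≡⟨ cong (_* b) (ℚₚ.*-comm a (q * r)) ⟩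
        q * r * a * b     ≡⟨ ℚₚ.*-assoc (q * r) a b ⟩
        q * r * (a * b)   ∎

  normKpow≡ : (n i k : ℕ) → 2 ∣ k → normKpow n i k ≡ ι (zeroSumTuples n i k)
  normKpow≡ n i .(q ℕ.* 2) (divides q refl) = begin
    ι (+ sum (map (λ y → ∣ K n i y ∣ ℕ.^ k) (cube n))) * half ^ℚ n
      ≡⟨ cong (λ z → ι z * half ^ℚ n) (trans (+sum≡∑ (cube n) (λ y → ∣ K n i y ∣ ℕ.^ k))
                                             (∑-cong (cube n) (λ y → +∣a∣^even (K n i y) q))) ⟩
    ι (∑ (cube n) (λ y → K n i y ℤ.^ k)) * half ^ℚ n
      ≡⟨ cong (λ z → ι z * half ^ℚ n) (∑-K^k n i k) ⟩
    ι (2ℤ ℤ.^ n ℤ.* zeroSumTuples n i k) * half ^ℚ n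
      ≡⟨ ι[2^j*z]*half^j n (zeroSumTuples n i k) ⟩
    ι (zeroSumTuples n i k) ∎
    where open ≡-Reasoning
          k = q ℕ.* 2

open import Data.Nat using (ℕ; _+_; _*_; _^_; _∸_; _<_; _≤_; suc)
open import Data.Nat.Divisibility using (_∣_)
open import Data.Rational as ℚ using (ℚ)

proposition1p3 : (n i m k : ℕ) →
    0 < i → 2 * i < n → 2 ∣ i →
    0 < m → (2 ^ m) * (i ^ i) * ((n ∸ i) ^ (n ∸ i)) < n ^ n →
    2 ≤ k → 2 ∣ k → k + 1 ≤ m →
    (half ℚ.* (p m ^ℚ (k ∸ 1)) ℚ.* normKpow n i k) ℚ.≤ centralMoment m n i k
proposition1p3 n i (suc m) (suc k) 0<i _ _ (ℕ.s≤s ℕ.z≤n) _ (ℕ.s≤s _) k-even _ = begin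
  half ℚ.* p (suc m) ^ℚ k ℚ.* normKpow n i (suc k)
    ≡⟨ cong (half ℚ.* p (suc m) ^ℚ k ℚ.*_) (normKpow≡ n i (suc k) k-even) ⟩
  half ℚ.* p (suc m) ^ℚ k ℚ.* ι N
    ≤⟨ ℚₚ.*-monoʳ-≤-nonNeg (ι N) {{ℚ.nonNegative (ι-mono (zeroSumTuples-nonNeg n i (suc k)))}}
         (ℚₚ.*-monoʳ-≤-nonNeg (p (suc m) ^ℚ k) {{p^-nonNeg (suc m) k}} (half≤1-p m)) ⟩
  (ℚ.1ℚ ℚ.- p (suc m)) ℚ.* p (suc m) ^ℚ k ℚ.* ι N
    ≤⟨ centralMoment-≥ (suc m) n i k 0<i ⟩
  centralMoment (suc m) n i (suc k) ∎
  where open ℚₚ.≤-Reasoning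
        N = zeroSumTuples n i (suc k)
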